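{- Let $G=(U,<_U,V,<_V,E)$ be an ordered bipartite graph and $q\ge1$ an integer, and let $G^{(q)}$ be any graph obtained from $G$ by the splitting construction described in the context. Then every vertex $u'\in U(G^{(q)})$ has degree exactly $q$, and $G^{(q)}$ has at least $|E|-(q-1)|U|$ edges. Furthermore, if $G$ avoids an ordered bipartite graph $T$ such that any two consecutive vertices of $U(T)$ have a common neighbor in $T$, then $G^{(q)}$ also avoids $T$.
   Context: An ordered bipartite graph is a tuple $G=(U,<_U,V,<_V,E)$ with $U,V$ disjoint linearly ordered vertex sets and $E\subseteq U\times V$. $G$ contains an ordered bipartite graph $T$ if there are injective order-preserving maps $U(T)\to U(G)$, $V(T)\to V(G)$ sending edges of $T$ to edges of $G$; otherwise $G$ avoids $T$. Splitting construction: $G^{(q)}=(U',<_{U'},V,<_V,E')$, where $U'$ is obtained by replacing each $u\in U$ by $\lfloor d_G(u)/q\rfloor$ new vertices; $<_{U'}$ compares vertices coming from different vertices of $U$ as their origins compare in $<_U$, and is arbitrary among vertices coming from the same $u$; $E'$ is chosen so that each vertex $u'\in U'$ coming from $u\in U$ is adjacent to exactly $q$ of the neighbors of $u$ in $G$, and distinct vertices of $U'$ coming from the same $u$ have disjoint neighborhoods. ($G^{(q)}$ need not be unique.) -}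

module Defs where

open import Data.Nat using (ℕ; zero; suc; _+_; _≤_; _/_; NonZero)
open import Data.Bool using (Bool; true; false; if_then_else_)
open import Data.Fin using (Fin; suc; toℕ) renaming (_<_ to _<F_)
open import Data.List using (List; map; allFin)
open import Data.Nat.ListAction using (sum)
open import Data.Product using (Σ; ∃; _×_; _,_)
open import Data.Empty using (⊥)
open import Relation.Binary.PropositionalEquality using (_≡_; _≢_; subst)
open import Relation.Nullary using (¬_)

-- A finite ordered bipartite graph: U = Fin m and V = Fin n, each with its
-- natural (linear) order; E is given by a Boolean adjacency function
-- (adj u v ≡ true iff (u , v) ∈ E).
record OBG : Set where
  constructor obg
  field
    m   : ℕ
    n   : ℕ
    adj : Fin m → Fin n → Bool
open OBG public

b2n : Bool → ℕ
b2n true  = 1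
b2n false = 0

countFin : (k : ℕ) → (Fin k → Bool) → ℕ
countFin k p = sum (map (λ i → b2n (p i)) (allFin k))

degree : (G : OBG) → Fin (m G) → ℕ
degree G u = countFin (n G) (adj G u)

edges : (G : OBG) → ℕ
edges G = sum (map (degree G) (allFin (m G)))

_==F_ : ∀ {k} → Fin k → Fin k → Bool
Fin.zero ==F Fin.zero = true
Fin.zero ==F suc j = false
suc i ==F Fin.zero = false
suc i ==F suc j = i ==F j

StrictMono : ∀ {a b} → (Fin a → Fin b) → Set
StrictMono f = ∀ i j → i <F j → f i <F f j

Contains : OBG → OBG → Set
Contains G T =
  Σ (Fin (m T) → Fin (m G)) λ φ →
  Σ (Fin (n T) → Fin (n G)) λ ψ →
  StrictMono φ × StrictMono ψ ×
  (∀ u v → adj T u v ≡ true → adj G (φ u) (ψ v) ≡ true)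

Avoids : OBG → OBG → Set
Avoids G T = ¬ Contains G T

ConsecutiveCommonNbr : OBG → Set
ConsecutiveCommonNbr T =
  ∀ (i j : Fin (m T)) → toℕ j ≡ suc (toℕ i) →
  ∃ λ v → adj T i v ≡ true × adj T j v ≡ true

-- The order on U' is its
-- natural order on Fin m'; the order among vertices with the same origin is
-- arbitrary, i.e. unconstrained beyond being some linear order.
record IsSplitting (q : ℕ) .{{_ : NonZero q}} (G : OBG) (m' : ℕ)
                   (adj' : Fin m' → Fin (n G) → Bool) : Set where
  G' : OBG
  G' = obg m' (n G) adj'
  field
    origin  : Fin m' → Fin (m G)
    order   : ∀ a b → origin a <F origin b → a <F b
    fibre   : ∀ u → countFin m' (λ u' → origin u' ==F u) ≡ degree G u / q
    nbrSub  : ∀ u' v → adj' u' v ≡ true → adj G (origin u') v ≡ true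
    nbrSize : ∀ u' → degree G' u' ≡ q
    disjoint : ∀ a b → a ≢ b → origin a ≡ origin b →
               ∀ v → adj' a v ≡ true → adj' b v ≡ true → ⊥

-- Write d(u) for the degree of u ∈ U.  Since the fibres of
--    the origin map partition U', we get  Σ_u ⌊d(u)/q⌋ = |U'|, and since G^(q)
--    is q-regular on U', |E'| = q·|U'|.  Division with remainder gives
--    d(u) ≤ q·⌊d(u)/q⌋ + (q-1); summing over u yields |E| ≤ |E'| + (q-1)|U|.
--  * Avoidance.  An embedding (φ, ψ) of T into G^(q) is pushed down to G by
--    composing φ with the origin map.  Edges survive because every edge of
--    G^(q) lies over an edge of G; the only issue is strict monotonicity of
--    origin ∘ φ.  It suffices to check consecutive vertices of U(T): their
--    images have weakly increasing origins by the order axiom, and distinct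
--    origins because they share a neighbour while vertices with the same
--    origin have disjoint neighbourhoods.
module Submission where

open import Defs
open import Data.Nat using (ℕ; _+_; _*_; _∸_; _≤_; NonZero)
open import Data.Fin using (Fin)
open import Data.Bool using (Bool)
open import Data.Product using (_×_)
open import Relation.Binary.PropositionalEquality using (_≡_)

open import Data.Nat using (zero; suc; _<_; _/_; _%_; z≤n)
open import Data.Bool using (true)
open import Data.Nat.Properties
open import Data.Nat.DivMod using (m≡m%n+[m/n]*n; m%n<n)
open import Data.Nat.ListAction using () renaming (sum to listSum)
import Data.Fin as F
import Data.Fin.Properties as FP
open import Data.List using (allFin; map; tabulate)
open import Data.List.Properties using (map-tabulate)
open import Data.Product using (_,_)
open import Data.Vec.Functional using (Vector)
open import Algebra.Properties.Semiring.Sum +-*-semiring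
  using (sum; sum-syntax; sum-cong-≗; sum-replicate-zero; ∑-distrib-+; ∑-comm;
         *-distribʳ-sum)
open import Relation.Binary.PropositionalEquality
  using (_≢_; refl; sym; trans; cong; cong₂; subst; module ≡-Reasoning)
open import Function using (_∘_)

listSum-allFin : ∀ k (f : Fin k → ℕ) → listSum (map f (allFin k)) ≡ ∑[ i < k ] f i
listSum-allFin k f = trans (cong listSum (map-tabulate (λ i → i) f)) (tabulated k f)
  where
  tabulated : ∀ k (f : Fin k → ℕ) → listSum (tabulate f) ≡ sum f
  tabulated zero    f = refl
  tabulated (suc k) f = cong (f F.zero +_) (tabulated k (f ∘ F.suc))

∑-mono-≤ : ∀ {k} (f g : Vector ℕ k) → (∀ i → f i ≤ g i) → sum f ≤ sum g
∑-mono-≤ {zero}  f g f≤g = z≤n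
∑-mono-≤ {suc k} f g f≤g = +-mono-≤ (f≤g F.zero) (∑-mono-≤ (f ∘ F.suc) (g ∘ F.suc) (f≤g ∘ F.suc))

∑-const : ∀ k c → ∑[ i < k ] c ≡ k * c
∑-const zero    c = refl
∑-const (suc k) c = cong (c +_) (∑-const k c)

∑-indicator : ∀ k (x : Fin k) → ∑[ u < k ] b2n (x ==F u) ≡ 1
∑-indicator (suc k) F.zero    = cong suc (sum-replicate-zero k)
∑-indicator (suc k) (F.suc x) = ∑-indicator k x

fibre-sizes-sum : ∀ a b (o : Fin a → Fin b) →
  ∑[ u < b ] countFin a (λ x → o x ==F u) ≡ a
fibre-sizes-sum a b o = begin
  ∑[ u < b ] countFin a (λ x → o x ==F u)     ≡⟨ sum-cong-≗ (λ u → listSum-allFin a (λ x → b2n (o x ==F u))) ⟩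
  ∑[ u < b ] ∑[ x < a ] b2n (o x ==F u)       ≡⟨ ∑-comm (λ u x → b2n (o x ==F u)) ⟩
  ∑[ x < a ] ∑[ u < b ] b2n (o x ==F u)       ≡⟨ sum-cong-≗ (λ x → ∑-indicator b (o x)) ⟩
  ∑[ x < a ] 1                                ≡⟨ trans (∑-const a 1) (*-identityʳ a) ⟩
  a                                           ∎
  where open ≡-Reasoning

edges-regular : ∀ (H : OBG) q → (∀ u → degree H u ≡ q) → edges H ≡ m H * q
edges-regular H q reg = begin
  edges H                  ≡⟨ listSum-allFin (m H) (degree H) ⟩
  ∑[ u < m H ] degree H u  ≡⟨ sum-cong-≗ reg ⟩
  ∑[ u < m H ] q           ≡⟨ ∑-const (m H) q ⟩
  m H * q                  ∎
  where open ≡-Reasoning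

division-slack : ∀ x q .{{_ : NonZero q}} → x ≤ (x / q) * q + (q ∸ 1)
division-slack x q = begin
  x                    ≡⟨ m≡m%n+[m/n]*n x q ⟩
  x % q + (x / q) * q  ≡⟨ +-comm (x % q) _ ⟩
  (x / q) * q + x % q  ≤⟨ +-monoʳ-≤ _ remainder≤ ⟩
  (x / q) * q + (q ∸ 1) ∎
  where
  open ≤-Reasoning
  remainder≤ : x % q ≤ q ∸ 1
  remainder≤ = subst (x % q ≤_) (pred[m∸n]≡m∸[1+n] q 0) (suc[m]≤n⇒m≤pred[n] (m%n<n x q))

consecutive⇒StrictMono : ∀ {a b} (f : Fin a → Fin b) →
  (∀ i j → F.toℕ j ≡ suc (F.toℕ i) → f i F.< f j) → StrictMono f
consecutive⇒StrictMono {a} f step i j i<j =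
  let d , i+1+d≡j = m≤n⇒∃[o]m+o≡n i<j
  in across d i j (sym (trans (cong suc (+-comm d (F.toℕ i))) i+1+d≡j))
  where
  across : ∀ d (i j : Fin a) → F.toℕ j ≡ suc (d + F.toℕ i) → f i F.< f j
  across zero    i j j≡ = step i j j≡
  across (suc d) i j j≡ = <-trans (across d i k toℕk) (step k j (trans j≡ (cong suc (sym toℕk))))
    where
    k<a : suc (d + F.toℕ i) < a
    k<a = <-trans (n<1+n _) (subst (_< a) j≡ (FP.toℕ<n j))
    k : Fin a
    k = F.fromℕ< k<a
    toℕk : F.toℕ k ≡ suc (d + F.toℕ i)
    toℕk = FP.toℕ-fromℕ< k<a

module _ {G : OBG} {q : ℕ} .{{_ : NonZero q}} {m' : ℕ}
         {adj' : Fin m' → Fin (n G) → Bool}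
         (split : IsSplitting q G m' adj') where

  open IsSplitting split

  size-of-U' : ∑[ u < m G ] (degree G u / q) ≡ m'
  size-of-U' = trans (sum-cong-≗ (sym ∘ fibre)) (fibre-sizes-sum m' (m G) origin)

  edge-count : edges G ≤ edges G' + (q ∸ 1) * m G
  edge-count = begin
    edges G                                          ≡⟨ listSum-allFin (m G) d ⟩
    ∑[ u < m G ] d u                                 ≤⟨ ∑-mono-≤ d _ (λ u → division-slack (d u) q) ⟩
    ∑[ u < m G ] ((d u / q) * q + (q ∸ 1))           ≡⟨ ∑-distrib-+ (λ u → (d u / q) * q) (λ _ → q ∸ 1) ⟩
    ∑[ u < m G ] ((d u / q) * q) + ∑[ u < m G ] (q ∸ 1)
                                                     ≡⟨ cong₂ _+_ new-edges (∑-const (m G) (q ∸ 1)) ⟩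
    edges G' + m G * (q ∸ 1)                         ≡⟨ cong (edges G' +_) (*-comm (m G) (q ∸ 1)) ⟩
    edges G' + (q ∸ 1) * m G                         ∎
    where
    open ≤-Reasoning
    d : Fin (m G) → ℕ
    d = degree G
    new-edges : ∑[ u < m G ] ((d u / q) * q) ≡ edges G'
    new-edges = trans (sym (*-distribʳ-sum q (λ u → d u / q)))
                      (trans (cong (_* q) size-of-U') (sym (edges-regular G' q nbrSize)))

  origin-increases : ∀ a b v → a F.< b → adj' a v ≡ true → adj' b v ≡ true →
                     origin a F.< origin b
  origin-increases a b v a<b av bv = FP.≤∧≢⇒< weakly distinct
    where
    weakly : origin a F.≤ origin b
    weakly = ≮⇒≥ (λ b<a → <-asym a<b (order b a b<a))
    distinct : origin a ≢ origin b
    distinct same = disjoint a b (λ { refl → <-irrefl refl a<b }) same v av bv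

  avoidance : (T : OBG) → ConsecutiveCommonNbr T → Avoids G T → Avoids G' T
  avoidance T common avoidsT (φ , ψ , φ-mono , ψ-mono , φψ-edges) =
    avoidsT (origin ∘ φ , ψ , origin∘φ-mono , ψ-mono ,
             λ u v uv → nbrSub (φ u) (ψ v) (φψ-edges u v uv))
    where
    origin∘φ-mono : StrictMono (origin ∘ φ)
    origin∘φ-mono = consecutive⇒StrictMono (origin ∘ φ) λ i j j≡ →
      let v , iv , jv = common i j j≡
          i<j = φ-mono i j (subst (F.toℕ i <_) (sym j≡) (n<1+n (F.toℕ i)))
      in origin-increases (φ i) (φ j) (ψ v) i<j (φψ-edges i v iv) (φψ-edges j v jv)

lemma4p2 : (G : OBG) (q : ℕ) .{{_ : NonZero q}}
    (m' : ℕ) (adj' : Fin m' → Fin (n G) → Bool) →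
    IsSplitting q G m' adj' →
    ((u' : Fin m') → degree (obg m' (n G) adj') u' ≡ q)
    × (edges G ≤ edges (obg m' (n G) adj') + (q ∸ 1) * m G)
    × ((T : OBG) → ConsecutiveCommonNbr T → Avoids G T →
       Avoids (obg m' (n G) adj') T)
lemma4p2 G q m' adj' split =
  IsSplitting.nbrSize split , edge-count split , avoidance split
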